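{- Let $G$ be a connected graph of order $m$ that is not complete, and let $n\ge2$. Then $m(n-1)+1\le Z(G\circ K_n)\le nm-2$.
   Context: $K_n$ is the complete graph on $n$ vertices. Zero forcing: given a set $S$ of initially black vertices (others white), the color-change rule turns a white vertex black if it is the only white neighbor of some black vertex; $S$ is a zero forcing set if eventually all vertices become black; $Z(G)$ is the minimum size of a zero forcing set. The lexicographic product $G\circ H$ has vertex set $V(G)\times V(H)$, with $(a,v)$ adjacent to $(b,w)$ iff $ab\in E(G)$, or $a=b$ and $vw\in E(H)$. -}

module Defs where

open import Data.Nat using (ℕ)
open import Data.Fin using (Fin; remQuot)
open import Data.Fin.Subset using (Subset; _∈_; _∉_; _∪_; ⁅_⁆; ⊤; ∣_∣)
open import Data.Product using (Σ; ∃; _×_; _,_; proj₁; proj₂)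
open import Data.Sum using (_⊎_)
open import Relation.Nullary using (¬_)
open import Relation.Binary.PropositionalEquality using (_≡_; _≢_)
open import Relation.Binary.Construct.Closure.ReflexiveTransitive using (Star)

record Graph (n : ℕ) : Set₁ where
  field
    Adj     : Fin n → Fin n → Set
    sym     : ∀ {u v} → Adj u v → Adj v u
    irrefl  : ∀ {u} → ¬ Adj u u
open Graph public

data Walk {n : ℕ} (G : Graph n) : Fin n → Fin n → Set where
  here : ∀ {u} → Walk G u u
  step : ∀ {u v w} → Adj G u v → Walk G v w → Walk G u w

Connected : ∀ {n} → Graph n → Set
Connected G = ∀ u v → Walk G u v

Complete : ∀ {n} → Graph n → Set
Complete G = ∀ u v → u ≢ v → Adj G u v

K : (n : ℕ) → Graph n
K n = record { Adj = λ i j → i ≢ j ; sym = λ p q → p (Relation.Binary.PropositionalEquality.sym q)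
             ; irrefl = λ p → p Relation.Binary.PropositionalEquality.refl }

-- Lexicographic product G ∘ H; vertex (a , v) is encoded as combine a v : Fin (m * n),
-- decoded by remQuot.
fstV : ∀ {m} n → Fin (m Data.Nat.* n) → Fin m
fstV {m} n x = proj₁ (remQuot {m} n x)

sndV : ∀ {m} n → Fin (m Data.Nat.* n) → Fin n
sndV {m} n x = proj₂ (remQuot {m} n x)

lexAdj : ∀ {m n} → Graph m → Graph n → Fin (m Data.Nat.* n) → Fin (m Data.Nat.* n) → Set
lexAdj {m} {n} G H x y =
  Adj G (fstV n x) (fstV n y)
  ⊎ (fstV {m} n x ≡ fstV n y × Adj H (sndV {m} n x) (sndV {m} n y))

lexSym : ∀ {m n} (G : Graph m) (H : Graph n) {x y} → lexAdj G H x y → lexAdj G H y x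
lexSym G H (Data.Sum.inj₁ p) = Data.Sum.inj₁ (sym G p)
lexSym G H (Data.Sum.inj₂ (e , p)) =
  Data.Sum.inj₂ (Relation.Binary.PropositionalEquality.sym e , sym H p)

lexIrrefl : ∀ {m n} (G : Graph m) (H : Graph n) {x} → ¬ lexAdj G H x x
lexIrrefl G H (Data.Sum.inj₁ p) = irrefl G p
lexIrrefl G H (Data.Sum.inj₂ (_ , p)) = irrefl H p

_∘ₗ_ : ∀ {m n} → Graph m → Graph n → Graph (m Data.Nat.* n)
G ∘ₗ H = record { Adj = lexAdj G H ; sym = lexSym G H ; irrefl = lexIrrefl G H }

data Force {n : ℕ} (G : Graph n) (S : Subset n) : Subset n → Set where
  force : (u w : Fin n) → u ∈ S → w ∉ S → Adj G u w →
          (∀ v → Adj G u v → v ≢ w → v ∈ S) →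
          Force G S (S ∪ ⁅ w ⁆)

ZeroForcingSet : ∀ {n} → Graph n → Subset n → Set
ZeroForcingSet G S = Star (Force G) S ⊤

IsZeroForcingNumber : ∀ {n} → Graph n → ℕ → Set
IsZeroForcingNumber G z =
  (Σ (Subset _) λ S → ZeroForcingSet G S × ∣ S ∣ ≡ z)
  × (∀ S → ZeroForcingSet G S → z Data.Nat.≤ ∣ S ∣)

-- Within a block {a} × V(Kₙ) of G ∘ Kₙ any two vertices are twins: they have the same
-- neighbours apart from each other.  A black vertex adjacent to one white twin is adjacent to
-- the other, so two white twins can never be forced; hence a zero forcing set misses at most
-- one vertex per block.  If it missed a vertex in every block, every black vertex would see
-- a white vertex in its own block and another one in a neighbouring block (G is connected
-- and not a single vertex), so no force could start; hence some block is entirely black,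
-- giving m(n - 1) + 1.  For the upper bound take two non-adjacent vertices a, b of G and
-- colour everything black except (a,0) and (b,0): then (a,1) forces (a,0), as it does not
-- see (b,0), and afterwards (b,1) forces (b,0).
module Submission where

open import Defs
open import Data.Nat using (ℕ; _+_; _*_; _∸_; _≤_)
open import Data.Product using (_×_)
open import Relation.Nullary using (¬_)

open import Data.Nat using (zero; suc; z≤n; s≤s; _≤?_)
open import Data.Nat.Properties
  using (≤-trans; m∸n≤m; +-mono-≤; +-suc; +-comm; *-comm; module ≤-Reasoning)
open import Data.Fin using (Fin; zero; suc; combine; _↑ˡ_; _↑ʳ_; _≟_)
open import Data.Fin.Properties
  using (all?; any?; ¬∀⟶∃¬; ∀-cons; remQuot-combine; combine-remQuot; combine-injectiveˡ; combine-injectiveʳ)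
open import Data.Fin.Subset using (Subset; _∈_; _∉_; _∪_; ⁅_⁆; ⊤; ∣_∣; ∁; inside; outside)
open import Data.Fin.Subset.Properties
  using (_∈?_; ∈⊤; ⊆⊤; ⊆-antisym; ∣⊤∣≡n; ∣∁p∣≡n∸∣p∣; ∣⁅x⁆∣≡1; p⊆q⇒∣p∣≤∣q∣; ∪-identityʳ
        ; x∈⁅x⁆; x∈⁅y⁆⇒x≡y; x≢y⇒x∉⁅y⁆; x∉⁅y⁆⇒x≢y; x∈p∪q⁺; x∈p∪q⁻; x∉p⇒x∈∁p; x∈p⇒x∉∁p; x∈∁p⇒x∉p)
open import Data.Vec using ([]; _∷_; _++_; splitAt; _[_]=_)
open import Data.Vec.Properties using ([]=⇒lookup; lookup⇒[]=; lookup-++ˡ; lookup-++ʳ)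
open import Data.Product using (∃; ∃₂; _,_; proj₁; proj₂)
open import Data.Sum using (_⊎_; inj₁; inj₂; [_,_])
import Data.Sum as Sum
open import Data.Empty using (⊥-elim)
open import Function using (_∘_)
open import Relation.Nullary using (yes; no; contradiction)
open import Relation.Nullary.Decidable using (decidable-stable; _×-dec_)
open import Relation.Nullary.Negation using (¬¬-map)
open import Relation.Binary.PropositionalEquality
  using (_≡_; _≢_; refl; trans; cong; subst; subst₂; module ≡-Reasoning) renaming (sym to ≡-sym)
open import Relation.Binary.Construct.Closure.ReflexiveTransitive using (Star; ε; _◅_)

¬¬-shift-Fin : ∀ k {P : Fin k → Set} → (∀ i → ¬ ¬ P i) → ¬ ¬ (∀ i → P i)
¬¬-shift-Fin zero    _    ¬all = ¬all λ ()
¬¬-shift-Fin (suc k) ¬¬P  ¬all =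
  ¬¬P zero λ P₀ → ¬¬-shift-Fin k (¬¬P ∘ suc) (¬all ∘ ∀-cons P₀)

combine-≢ˡ : ∀ {m n} {a b : Fin m} (v w : Fin n) → a ≢ b → combine a v ≢ combine b w
combine-≢ˡ {a = a} {b} v w a≢b = a≢b ∘ combine-injectiveˡ a v b w

combine-≢ʳ : ∀ {m n} (a b : Fin m) {v w : Fin n} → v ≢ w → combine a v ≢ combine b w
combine-≢ʳ a b {v} {w} v≢w = v≢w ∘ combine-injectiveʳ a v b w

x∉p⇒∣p∪⁅x⁆∣≡1+∣p∣ : ∀ {N} (p : Subset N) {x} → x ∉ p → ∣ p ∪ ⁅ x ⁆ ∣ ≡ suc ∣ p ∣
x∉p⇒∣p∪⁅x⁆∣≡1+∣p∣ (outside ∷ p) {zero}  _   = cong (suc ∘ ∣_∣) (∪-identityʳ p)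
x∉p⇒∣p∪⁅x⁆∣≡1+∣p∣ (inside  ∷ p) {zero}  x∉p = contradiction _[_]=_.here x∉p
x∉p⇒∣p∪⁅x⁆∣≡1+∣p∣ (outside ∷ p) {suc x} x∉p = x∉p⇒∣p∪⁅x⁆∣≡1+∣p∣ p (x∉p ∘ _[_]=_.there)
x∉p⇒∣p∪⁅x⁆∣≡1+∣p∣ (inside  ∷ p) {suc x} x∉p = cong suc (x∉p⇒∣p∪⁅x⁆∣≡1+∣p∣ p (x∉p ∘ _[_]=_.there))

x∉p∪⁅y⁆ : ∀ {N} {p : Subset N} {x y} → x ∉ p → x ≢ y → x ∉ p ∪ ⁅ y ⁆
x∉p∪⁅y⁆ {p = p} {y = y} x∉p x≢y = [ x∉p , x≢y ∘ x∈⁅y⁆⇒x≡y y ] ∘ x∈p∪q⁻ p ⁅ y ⁆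

x∈p∪⁅x⁆ : ∀ {N} {p : Subset N} x → x ∈ p ∪ ⁅ x ⁆
x∈p∪⁅x⁆ x = x∈p∪q⁺ (inj₂ (x∈⁅x⁆ x))

full⇒n≤∣p∣ : ∀ {n} (p : Subset n) → (∀ v → v ∈ p) → n ≤ ∣ p ∣
full⇒n≤∣p∣ {n} p full = subst (_≤ ∣ p ∣) (∣⊤∣≡n n) (p⊆q⇒∣p∣≤∣q∣ {p = ⊤} λ {v} _ → full v)

MissesAtMostOne : ∀ {n} → Subset n → Set
MissesAtMostOne p = ∀ {v w} → v ≢ w → v ∈ p ⊎ w ∈ p

missesAtMostOne⇒n∸1≤∣p∣ : ∀ {n} (p : Subset n) → MissesAtMostOne p → n ∸ 1 ≤ ∣ p ∣
missesAtMostOne⇒n∸1≤∣p∣ {n} p misses with all? (_∈? p)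
... | yes full = ≤-trans (m∸n≤m n 1) (full⇒n≤∣p∣ p full)
... | no ¬full with ¬∀⟶∃¬ n _ (_∈? p) ¬full
...   | x , x∉p = begin
  n ∸ 1               ≡⟨ cong (n ∸_) (∣⁅x⁆∣≡1 x) ⟨
  n ∸ ∣ ⁅ x ⁆ ∣       ≡⟨ ∣∁p∣≡n∸∣p∣ ⁅ x ⁆ ⟨
  ∣ ∁ ⁅ x ⁆ ∣         ≤⟨ p⊆q⇒∣p∣≤∣q∣ ∁⁅x⁆⊆p ⟩
  ∣ p ∣               ∎
  where
  open ≤-Reasoning
  ∁⁅x⁆⊆p : ∀ {v} → v ∈ ∁ ⁅ x ⁆ → v ∈ p
  ∁⁅x⁆⊆p {v} v∈∁⁅x⁆ = [ (λ v∈p → v∈p) , (λ x∈p → contradiction x∈p x∉p) ]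
    (misses (x∉⁅y⁆⇒x≢y (x∈∁p⇒x∉p v∈∁⁅x⁆)))

allBut : ∀ {N} → Fin N → Fin N → Subset N
allBut x y = ∁ (⁅ x ⁆ ∪ ⁅ y ⁆)

∣allBut∣ : ∀ {N} {x y : Fin N} → x ≢ y → ∣ allBut x y ∣ ≡ N ∸ 2
∣allBut∣ {N} {x} {y} x≢y = begin
  ∣ ∁ (⁅ x ⁆ ∪ ⁅ y ⁆) ∣   ≡⟨ ∣∁p∣≡n∸∣p∣ (⁅ x ⁆ ∪ ⁅ y ⁆) ⟩
  N ∸ ∣ ⁅ x ⁆ ∪ ⁅ y ⁆ ∣   ≡⟨ cong (N ∸_) (x∉p⇒∣p∪⁅x⁆∣≡1+∣p∣ ⁅ x ⁆ (x≢y⇒x∉⁅y⁆ (x≢y ∘ ≡-sym))) ⟩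
  N ∸ suc ∣ ⁅ x ⁆ ∣       ≡⟨ cong (λ k → N ∸ suc k) (∣⁅x⁆∣≡1 x) ⟩
  N ∸ 2                   ∎
  where open ≡-Reasoning

∈allBut : ∀ {N} {x y v : Fin N} → v ≢ x → v ≢ y → v ∈ allBut x y
∈allBut v≢x v≢y = x∉p⇒x∈∁p (x∉p∪⁅y⁆ (x≢y⇒x∉⁅y⁆ v≢x) v≢y)

∉allButˡ : ∀ {N} (x y : Fin N) → x ∉ allBut x y
∉allButˡ x y = x∈p⇒x∉∁p (x∈p∪q⁺ (inj₁ (x∈⁅x⁆ x)))

∉allButʳ : ∀ {N} (x y : Fin N) → y ∉ allBut x y
∉allButʳ x y = x∈p⇒x∉∁p (x∈p∪⁅x⁆ y)

∣p++q∣≡∣p∣+∣q∣ : ∀ {k l} (p : Subset k) (q : Subset l) → ∣ p ++ q ∣ ≡ ∣ p ∣ + ∣ q ∣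
∣p++q∣≡∣p∣+∣q∣ []            q = refl
∣p++q∣≡∣p∣+∣q∣ (outside ∷ p) q = ∣p++q∣≡∣p∣+∣q∣ p q
∣p++q∣≡∣p∣+∣q∣ (inside  ∷ p) q = cong suc (∣p++q∣≡∣p∣+∣q∣ p q)

↑ˡ∈p++q⇒∈p : ∀ {k l} (p : Subset k) (q : Subset l) {i} → i ↑ˡ l ∈ p ++ q → i ∈ p
↑ˡ∈p++q⇒∈p p q {i} i∈ = lookup⇒[]= i p (trans (≡-sym (lookup-++ˡ p q i)) ([]=⇒lookup i∈))

↑ʳ∈p++q⇒∈q : ∀ {k l} (p : Subset k) (q : Subset l) {i} → k ↑ʳ i ∈ p ++ q → i ∈ q
↑ʳ∈p++q⇒∈q p q {i} i∈ = lookup⇒[]= i q (trans (≡-sym (lookup-++ʳ p q i)) ([]=⇒lookup i∈))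

-- The a-th block of a subset of Fin (m * n) is {combine a v | v : Fin n}; for a = 0 it is
-- the first n entries of the vector, which is how the counting lemmas below recurse.
EachBlockMissesAtMostOne : ∀ {m n} → Subset (m * n) → Set
EachBlockMissesAtMostOne {m} {n} S =
  ∀ (a : Fin m) {v w : Fin n} → v ≢ w → combine a v ∈ S ⊎ combine a w ∈ S

module _ {m n} (p : Subset n) (q : Subset (m * n))
         (blocks : EachBlockMissesAtMostOne {suc m} (p ++ q)) where

  firstBlockMissesAtMostOne : MissesAtMostOne p
  firstBlockMissesAtMostOne = Sum.map (↑ˡ∈p++q⇒∈p p q) (↑ˡ∈p++q⇒∈p p q) ∘ blocks zero

  otherBlocksMissAtMostOne : EachBlockMissesAtMostOne {m} q
  otherBlocksMissAtMostOne a = Sum.map (↑ʳ∈p++q⇒∈q p q) (↑ʳ∈p++q⇒∈q p q) ∘ blocks (suc a)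

m*[n∸1]≤∣S∣ : ∀ m {n} (S : Subset (m * n)) → EachBlockMissesAtMostOne S → m * (n ∸ 1) ≤ ∣ S ∣
m*[n∸1]≤∣S∣ zero    S _ = z≤n
m*[n∸1]≤∣S∣ (suc m) {n} S blocks with splitAt n S
... | p , q , refl = subst (_ ≤_) (≡-sym (∣p++q∣≡∣p∣+∣q∣ p q)) (+-mono-≤
  (missesAtMostOne⇒n∸1≤∣p∣ p (firstBlockMissesAtMostOne {m} p q blocks))
  (m*[n∸1]≤∣S∣ m q (otherBlocksMissAtMostOne {m} p q blocks)))

1+m*n≤∣S∣ : ∀ m {n} (S : Subset (m * suc n)) → EachBlockMissesAtMostOne S →
            (a : Fin m) → (∀ v → combine a v ∈ S) → suc (m * n) ≤ ∣ S ∣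
1+m*n≤∣S∣ (suc m) {n} S blocks a full with splitAt (suc n) S
1+m*n≤∣S∣ (suc m) {n} S blocks zero full | p , q , refl =
  subst (_ ≤_) (≡-sym (∣p++q∣≡∣p∣+∣q∣ p q)) (+-mono-≤
    (full⇒n≤∣p∣ p (↑ˡ∈p++q⇒∈p p q ∘ full))
    (m*[n∸1]≤∣S∣ m q (otherBlocksMissAtMostOne {m} p q blocks)))
1+m*n≤∣S∣ (suc m) {n} S blocks (suc a) full | p , q , refl =
  subst₂ _≤_ (+-suc n (m * n)) (≡-sym (∣p++q∣≡∣p∣+∣q∣ p q)) (+-mono-≤
    (missesAtMostOne⇒n∸1≤∣p∣ p (firstBlockMissesAtMostOne {m} p q blocks))
    (1+m*n≤∣S∣ m q (otherBlocksMissAtMostOne {m} p q blocks) a (↑ʳ∈p++q⇒∈q p q ∘ full)))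

Twins : ∀ {N} → Graph N → Fin N → Fin N → Set
Twins H x y = (∀ {u} → u ≢ y → Adj H u x → Adj H u y) × (∀ {u} → u ≢ x → Adj H u y → Adj H u x)

adjacent⇒≢ : ∀ {N} (H : Graph N) {u v} → Adj H u v → u ≢ v
adjacent⇒≢ H uv refl = irrefl H uv

module _ {N} {H : Graph N} where

  force-keepsTwinWhite : ∀ {x y T T'} → (∀ {u} → u ≢ y → Adj H u x → Adj H u y) →
                         x ≢ y → x ∉ T → y ∉ T → Force H T T' → x ∉ T'
  force-keepsTwinWhite {x} {y} x→y x≢y x∉T y∉T (force u w u∈T _ ux others) = x∉p∪⁅y⁆ x∉T x≢w
    where
    u≢y : u ≢ y
    u≢y refl = y∉T u∈T
    x≢w : x ≢ w
    x≢w refl = y∉T (others y (x→y u≢y ux) (x≢y ∘ ≡-sym))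

  whiteTwins-stayWhite : ∀ {x y T T'} → Twins H x y → x ≢ y → x ∉ T → y ∉ T →
                         Star (Force H) T T' → x ∉ T' × y ∉ T'
  whiteTwins-stayWhite _                 _   x∉T y∉T ε          = x∉T , y∉T
  whiteTwins-stayWhite twins@(x→y , y→x) x≢y x∉T y∉T (f ◅ fs) = whiteTwins-stayWhite twins x≢y
    (force-keepsTwinWhite x→y x≢y x∉T y∉T f) (force-keepsTwinWhite y→x (x≢y ∘ ≡-sym) y∉T x∉T f) fs

  zeroForcingSet-meetsTwins : ∀ {S x y} → ZeroForcingSet H S → Twins H x y → x ≢ y → x ∈ S ⊎ y ∈ S
  zeroForcingSet-meetsTwins {S} {x} {y} zfs twins x≢y with x ∈? S | y ∈? S
  ... | yes x∈S | _       = inj₁ x∈S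
  ... | no _    | yes y∈S = inj₂ y∈S
  ... | no x∉S  | no y∉S  = ⊥-elim (proj₁ (whiteTwins-stayWhite twins x≢y x∉S y∉S zfs) ∈⊤)

  zeroForcingSet-full⊎forces : ∀ {S} → ZeroForcingSet H S → S ≡ ⊤ ⊎ ∃ (Force H S)
  zeroForcingSet-full⊎forces ε       = inj₁ refl
  zeroForcingSet-full⊎forces (f ◅ _) = inj₂ (_ , f)

  allBut-zeroForcing : ∀ {x y u u'} → x ≢ y → u ≢ y → Adj H u x → ¬ Adj H u y →
                       Adj H u' y → ZeroForcingSet H (allBut x y)
  allBut-zeroForcing {x} {y} {u} {u'} x≢y u≢y ux ¬uy u'y =
    subst (Star (Force H) S) everything (forceˣ ◅ forceʸ ◅ ε)
    where
    S : Subset N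
    S = allBut x y

    forceˣ : Force H S (S ∪ ⁅ x ⁆)
    forceˣ = force u x (∈allBut (adjacent⇒≢ H ux) u≢y) (∉allButˡ x y) ux
      λ v uv v≢x → ∈allBut v≢x λ { refl → ¬uy uv }

    blackAfterˣ : ∀ {v} → v ≢ y → v ∈ S ∪ ⁅ x ⁆
    blackAfterˣ {v} v≢y with v ≟ x
    ... | yes refl = x∈p∪⁅x⁆ x
    ... | no v≢x   = x∈p∪q⁺ (inj₁ (∈allBut v≢x v≢y))

    forceʸ : Force H (S ∪ ⁅ x ⁆) ((S ∪ ⁅ x ⁆) ∪ ⁅ y ⁆)
    forceʸ = force u' y (blackAfterˣ (adjacent⇒≢ H u'y)) (x∉p∪⁅y⁆ (∉allButʳ x y) (x≢y ∘ ≡-sym)) u'y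
      λ v _ → blackAfterˣ

    blackAfterʸ : ∀ v → v ∈ (S ∪ ⁅ x ⁆) ∪ ⁅ y ⁆
    blackAfterʸ v with v ≟ y
    ... | yes refl = x∈p∪⁅x⁆ y
    ... | no v≢y   = x∈p∪q⁺ (inj₁ (blackAfterˣ v≢y))

    everything : (S ∪ ⁅ x ⁆) ∪ ⁅ y ⁆ ≡ ⊤
    everything = ⊆-antisym ⊆⊤ λ {v} _ → blackAfterʸ v

module _ {m} (G : Graph m) (n : ℕ) where

  private
    H : Graph (m * n)
    H = G ∘ₗ K n

  fstV-combine : ∀ (a : Fin m) (v : Fin n) → fstV {m} n (combine a v) ≡ a
  fstV-combine a v = cong proj₁ (remQuot-combine a v)

  sndV-combine : ∀ (a : Fin m) (v : Fin n) → sndV {m} n (combine a v) ≡ v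
  sndV-combine a v = cong proj₂ (remQuot-combine a v)

  adj-sameBlock : ∀ {u} {a : Fin m} {v : Fin n} → fstV {m} n u ≡ a → u ≢ combine a v →
                  Adj H u (combine a v)
  adj-sameBlock {u} {a} {v} refl u≢av = inj₂ (≡-sym (fstV-combine a v) , u≢av ∘ u≡av)
    where
    open ≡-Reasoning
    u≡av : sndV {m} n u ≡ sndV {m} n (combine a v) → u ≡ combine a v
    u≡av same = begin
      u                                      ≡⟨ combine-remQuot {m} n u ⟨
      combine (fstV {m} n u) (sndV {m} n u)  ≡⟨ cong (combine a) (trans same (sndV-combine a v)) ⟩
      combine a v                            ∎

  adj-neighbourBlock : ∀ {u b} {v : Fin n} → Adj G (fstV {m} n u) b → Adj H u (combine b v)
  adj-neighbourBlock {b = b} {v} ub = inj₁ (subst (Adj G _) (≡-sym (fstV-combine b v)) ub)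

  ¬adj-otherBlock : ∀ {a b : Fin m} {v w : Fin n} → a ≢ b → ¬ Adj G a b →
                    ¬ Adj H (combine a v) (combine b w)
  ¬adj-otherBlock {a} {b} {v} {w} _   ¬ab (inj₁ ab) =
    ¬ab (subst₂ (Adj G) (fstV-combine a v) (fstV-combine b w) ab)
  ¬adj-otherBlock {a} {b} {v} {w} a≢b _   (inj₂ (e , _)) =
    a≢b (trans (≡-sym (fstV-combine a v)) (trans e (fstV-combine b w)))

  blockmates-twins : ∀ (a : Fin m) (v w : Fin n) → Twins H (combine a v) (combine a w)
  blockmates-twins a v w = toBlockmate v w , toBlockmate w v
    where
    toBlockmate : ∀ (v w : Fin n) {u} → u ≢ combine a w →
                  Adj H u (combine a v) → Adj H u (combine a w)
    toBlockmate v w _    (inj₁ ua) =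
      adj-neighbourBlock {v = w} (subst (Adj G _) (fstV-combine a v) ua)
    toBlockmate v w u≢aw (inj₂ (e , _)) =
      adj-sameBlock {a = a} {v = w} (trans e (fstV-combine a v)) u≢aw

  noForce-whenEveryBlockHasWhite : (∀ a → ∃ (Adj G a)) → ∀ {S} → (∀ a → ∃ λ v → combine a v ∉ S) →
                                   ∀ {T} → ¬ Force H S T
  noForce-whenEveryBlockHasWhite neighbour {S} white (force u w u∈S _ _ others)
    with b , ab ← neighbour (fstV {m} n u) | v , x∉S ← white (fstV {m} n u)
    with v' , y∉S ← white b =
    combine-≢ˡ v v' (adjacent⇒≢ G ab)
      (trans (whiteNeighbour≡w ux x∉S) (≡-sym (whiteNeighbour≡w uy y∉S)))
    where
    whiteNeighbour≡w : ∀ {z} → Adj H u z → z ∉ S → z ≡ w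
    whiteNeighbour≡w {z} uz z∉S = decidable-stable (z ≟ w) λ z≢w → z∉S (others z uz z≢w)

    ux : Adj H u (combine (fstV {m} n u) v)
    ux = adj-sameBlock refl λ u≡x → x∉S (subst (_∈ S) u≡x u∈S)

    uy : Adj H u (combine b v')
    uy = adj-neighbourBlock ab

  someBlockFull : (∀ a → ∃ (Adj G a)) → Fin m → ∀ {S} → ZeroForcingSet H S →
                  ∃ λ a → ∀ v → combine a v ∈ S
  someBlockFull neighbour a₀ {S} zfs with zeroForcingSet-full⊎forces zfs
  ... | inj₁ refl    = a₀ , λ _ → ∈⊤
  ... | inj₂ (_ , f) with any? (λ a → all? (λ v → combine a v ∈? S))
  ...   | yes full = full
  ...   | no ¬full = ⊥-elim (noForce-whenEveryBlockHasWhite neighbour white f)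
    where
    white : ∀ a → ∃ λ v → combine a v ∉ S
    white a = ¬∀⟶∃¬ n _ (λ v → combine a v ∈? S) λ allBlack → ¬full (a , allBlack)

zeroForcingSet-size≥ : ∀ {m n} (G : Graph m) → (∀ a → ∃ (Adj G a)) → Fin m →
                       ∀ {S} → ZeroForcingSet (G ∘ₗ K (suc n)) S → suc (m * n) ≤ ∣ S ∣
zeroForcingSet-size≥ {m} {n} G neighbour a₀ {S} zfs
  with a , full ← someBlockFull G (suc n) neighbour a₀ zfs =
  1+m*n≤∣S∣ m S blocksMissAtMostOne a full
  where
  blocksMissAtMostOne : EachBlockMissesAtMostOne {m} S
  blocksMissAtMostOne a {v} {w} v≢w =
    zeroForcingSet-meetsTwins zfs (blockmates-twins G (suc n) a v w) (combine-≢ʳ a a v≢w)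

nonadjacent⇒allBut-zeroForcing : ∀ {m k} (G : Graph m) {a b} → a ≢ b → ¬ Adj G a b →
  ZeroForcingSet (G ∘ₗ K (suc (suc k))) (allBut (combine a zero) (combine b zero))
nonadjacent⇒allBut-zeroForcing {m} {k} G {a} {b} a≢b ¬ab = allBut-zeroForcing
  (combine-≢ˡ zero zero a≢b)
  (combine-≢ˡ (suc zero) zero a≢b)
  (adj-sameBlock G n (fstV-combine G n a (suc zero)) (combine-≢ʳ a a λ ()))
  (¬adj-otherBlock G n a≢b ¬ab)
  (adj-sameBlock G n (fstV-combine G n b (suc zero)) (combine-≢ʳ b b λ ()))
  where
  n : ℕ
  n = suc (suc k)

walk-firstStep : ∀ {m} {G : Graph m} {a c} → Walk G a c → a ≢ c → ∃ (Adj G a)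
walk-firstStep here         a≢a = contradiction refl a≢a
walk-firstStep (step ab _) _   = _ , ab

connected⇒noIsolated : ∀ {m} {G : Graph m} → Connected G → ∀ {a b} → a ≢ b → ∀ c → ∃ (Adj G c)
connected⇒noIsolated conn {a} {b} a≢b c with c ≟ a
... | yes refl = walk-firstStep (conn c b) a≢b
... | no c≢a   = walk-firstStep (conn c a) c≢a

Nonadjacent : ∀ {m} → Graph m → Set
Nonadjacent G = ∃₂ λ a b → a ≢ b × ¬ Adj G a b

-- Adjacency need not be decidable, so a missing edge is only available under ¬ ¬.
¬complete⇒¬¬nonadjacent : ∀ {m} (G : Graph m) → ¬ Complete G → ¬ ¬ Nonadjacent G
¬complete⇒¬¬nonadjacent {m} G ¬complete noMissingEdge =
  ¬¬-shift-Fin m (λ a → ¬¬-shift-Fin m (edge a)) ¬complete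
  where
  edge : ∀ a b → ¬ ¬ (a ≢ b → Adj G a b)
  edge a b ¬edge = noMissingEdge
    (a , b , (λ a≡b → ¬edge λ a≢b → contradiction a≡b a≢b) , (λ ab → ¬edge λ _ → ab))

mainTheorem20 : (m n : ℕ) (G : Graph m) → Connected G → ¬ Complete G → 2 ≤ n →
    (z : ℕ) → IsZeroForcingNumber (G ∘ₗ K n) z →
    (m * (n ∸ 1) + 1 ≤ z) × (z ≤ n * m ∸ 2)
mainTheorem20 m (suc (suc k)) G conn ¬complete (s≤s (s≤s z≤n)) _ ((S , zfs , refl) , minimal) =
  decidable-stable (_ ≤? _ ×-dec _ ≤? _) (¬¬-map bounds (¬complete⇒¬¬nonadjacent G ¬complete))
  where
  n : ℕ
  n = suc (suc k)

  bounds : Nonadjacent G → (m * suc k + 1 ≤ ∣ S ∣) × (∣ S ∣ ≤ n * m ∸ 2)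
  bounds (a , b , a≢b , ¬ab) = lower , upper
    where
    lower : m * suc k + 1 ≤ ∣ S ∣
    lower = subst (_≤ ∣ S ∣) (+-comm 1 (m * suc k))
      (zeroForcingSet-size≥ G (connected⇒noIsolated conn a≢b) a zfs)
    upper : ∣ S ∣ ≤ n * m ∸ 2
    upper = subst (∣ S ∣ ≤_)
      (trans (∣allBut∣ (combine-≢ˡ zero zero a≢b)) (cong (_∸ 2) (*-comm m n)))
      (minimal _ (nonadjacent⇒allBut-zeroForcing G a≢b ¬ab))
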